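{- Let $n\geq 2$. Then the irregularity $irr(\Lambda_n)$ equals the number of ordered pairs $(e,e')\in E(\Lambda_n)^2$ such that $e'$ is an imbalanced edge for $e$.
   Context: The hypercube $Q_n$ has vertex set the binary strings of length $n$, adjacency meaning differing in exactly one position. For $x=x_1\ldots x_n$, $x+\delta_i$ is $x$ with its $i$-th coordinate complemented; the edge $\{x,x+\delta_i\}$ uses direction $i$, its endpoint with $i$-th coordinate 1 is the upper endpoint and the other the lower endpoint. A Lucas string of length $n$ is a binary string $b_1\ldots b_n$ with no two consecutive 1's and $b_1b_n\neq1$; $\Lambda_n$ is the subgraph of $Q_n$ induced by the Lucas strings of length $n$. The imbalance of an edge $\{x,y\}$ is $|d(x)-d(y)|$ (degrees in the graph) and $irr(G)=\sum_{e\in E(G)}imb(e)$. An edge $e'=\{y,y+\delta_j\}$ of $\Lambda_n$ at the lower endpoint $y$ of an edge $e=\{x,y\}$ of $\Lambda_n$ is an imbalanced edge for $e$ if $x+\delta_j\notin V(\Lambda_n)$. -}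

module Defs where

open import Data.Bool using (Bool; true; false; not; _∧_; if_then_else_)
open import Data.Nat using (ℕ; zero; suc; _+_; ∣_-_∣)
open import Data.Fin using (Fin)
open import Data.Vec using (Vec; []; _∷_; lookup; updateAt; last)
open import Data.List using (List; []; _∷_; _++_; map; concatMap; length; filter; allFin; cartesianProduct)
open import Data.Nat.ListAction using (sum)
open import Data.Product using (_×_; _,_; proj₁; proj₂)
open import Relation.Nullary.Decidable using (Dec)
open import Relation.Binary.PropositionalEquality using (_≡_)
open import Data.Bool.Properties using () renaming (_≟_ to _≟B_)

-- Vertices of Q_n: binary strings of length n (true = 1, false = 0).
Word : ℕ → Set
Word n = Vec Bool n

flip : ∀ {n} → Word n → Fin n → Word n
flip x i = updateAt x i not

allWords : (n : ℕ) → List (Word n)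
allWords zero = [] ∷ []
allWords (suc n) = map (false ∷_) (allWords n) ++ map (true ∷_) (allWords n)

noConsecOnes : ∀ {n} → Word n → Bool
noConsecOnes [] = true
noConsecOnes (a ∷ []) = true
noConsecOnes (a ∷ b ∷ v) = not (a ∧ b) ∧ noConsecOnes (b ∷ v)

isLucas : ∀ {n} → Word n → Bool
isLucas [] = true
isLucas (a ∷ v) = noConsecOnes (a ∷ v) ∧ not (a ∧ last (a ∷ v))

InΛ : ∀ {n} → Word n → Set
InΛ x = isLucas x ≡ true

deg : ∀ {n} → Word n → ℕ
deg {n} x = length (filter (λ i → isLucas (flip x i) ≟B true) (allFin n))

-- Edges of Λ_n, each represented exactly once as (y , i) where y is the
-- lower endpoint (y_i = 0) and the edge is {y , y + δ_i}; both ends Lucas.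
isEdgeLow : ∀ {n} → Word n × Fin n → Bool
isEdgeLow (y , i) = isLucas y ∧ not (lookup y i) ∧ isLucas (flip y i)

edges : (n : ℕ) → List (Word n × Fin n)
edges n = filter (λ e → isEdgeLow e ≟B true) (cartesianProduct (allWords n) (allFin n))

imb : ∀ {n} → Word n × Fin n → ℕ
imb (y , i) = ∣ deg y - deg (flip y i) ∣

irr : ℕ → ℕ
irr n = sum (map imb (edges n))

-- For e = {x , y} with lower endpoint y and x = y + δ_i, the edge
-- e' = {y , y + δ_j} is an edge of Λ_n at y, and it is an imbalanced edge
-- for e iff x + δ_j ∉ V(Λ_n).  Since e' is determined by j, ordered pairs
-- (e , e') correspond to pairs (e , j).
isImbalancedFor : ∀ {n} → Word n × Fin n → Fin n → Bool
isImbalancedFor (y , i) j =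
  isLucas y ∧ isLucas (flip y j) ∧ not (isLucas (flip (flip y i) j))

imbalancedPairCount : ℕ → ℕ
imbalancedPairCount n =
  length (filter (λ p → isImbalancedFor (proj₁ p) (proj₂ p) ≟B true)
                 (cartesianProduct (edges n) (allFin n)))

-- Lucas strings are closed under clearing bits.  Hence, for an edge with
-- lower endpoint y and upper endpoint x = y + δ_i, every direction j with
-- x + δ_j ∈ Λ_n also has y + δ_j ∈ Λ_n (for j = i this is x itself, for
-- j ≠ i because y + δ_j lies below x + δ_j).  So d(y) − d(x) counts exactly
-- the directions j giving an imbalanced edge for e, and summing over the
-- edges turns irr(Λ_n) into the number of such pairs.
module Submission where

open import Defs
open import Data.Nat using (ℕ; suc; _≥_; _+_; ∣_-_∣)
open import Data.Nat.Properties using (+-suc; ∣m-m+n∣≡n; ∣-∣-comm)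
open import Data.Nat.ListAction using (sum)
open import Data.Bool using (Bool; true; false; not; _∧_; _≤_; b≤b; f≤t)
open import Data.Bool.Properties
  using (≤-refl; ≤-minimum; ≤-maximum; ∧-conicalˡ; ∧-conicalʳ; not-injective)
  renaming (_≟_ to _≟B_)
open import Data.Fin as Fin using (Fin; _≟_)
open import Data.Vec using ([]; _∷_; lookup; last)
open import Data.Vec.Properties using (updateAt-commutes; lookup∘updateAt′)
open import Data.Vec.Relation.Binary.Pointwise.Inductive as Pointwise
  using (Pointwise; []; _∷_)
open import Data.List using (List; []; _∷_; _++_; map; length; filter; allFin; cartesianProduct)
open import Data.List.Properties using (length-++; filter-++; filter-≐; map-cong-local)
import Data.List.Relation.Unary.All as All
open import Data.List.Relation.Unary.All.Properties using (all-filter)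
open import Data.Product using (_×_; _,_; proj₁; proj₂)
open import Relation.Binary.PropositionalEquality
  using (_≡_; _≢_; refl; sym; trans; cong; cong₂; subst; module ≡-Reasoning)
open import Relation.Nullary using (yes; no)

∧-mono-≤ : ∀ {a a′ b b′} → a ≤ a′ → b ≤ b′ → a ∧ b ≤ a′ ∧ b′
∧-mono-≤ {b′ = b′} f≤t _ = ≤-minimum b′
∧-mono-≤ {a = true} b≤b q = q
∧-mono-≤ {a = false} b≤b _ = b≤b

not-antimono-≤ : ∀ {a b} → a ≤ b → not b ≤ not a
not-antimono-≤ f≤t = f≤t
not-antimono-≤ b≤b = b≤b

infix 4 _≤ᵥ_

_≤ᵥ_ : ∀ {n} → Word n → Word n → Set
_≤ᵥ_ = Pointwise _≤_

≤ᵥ-flip : ∀ {n} (y : Word n) i → lookup y i ≡ false → y ≤ᵥ flip y i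
≤ᵥ-flip (b ∷ y) Fin.zero refl = f≤t ∷ Pointwise.refl ≤-refl
≤ᵥ-flip (b ∷ y) (Fin.suc i) yᵢ≡0 = ≤-refl ∷ ≤ᵥ-flip y i yᵢ≡0

flip-≤ᵥ-flip-flip : ∀ {n} (y : Word n) {i j} → lookup y i ≡ false → i ≢ j →
                    flip y j ≤ᵥ flip (flip y i) j
flip-≤ᵥ-flip-flip y {i} {j} yᵢ≡0 i≢j =
  subst (flip y j ≤ᵥ_) (updateAt-commutes i j i≢j y)
        (≤ᵥ-flip (flip y j) i (trans (lookup∘updateAt′ i j i≢j y) yᵢ≡0))

noConsecOnes-antimono : ∀ {n} {v u : Word n} → v ≤ᵥ u → noConsecOnes u ≤ noConsecOnes v
noConsecOnes-antimono [] = b≤b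
noConsecOnes-antimono (_ ∷ []) = b≤b
noConsecOnes-antimono (p ∷ q ∷ ps) =
  ∧-mono-≤ (not-antimono-≤ (∧-mono-≤ p q)) (noConsecOnes-antimono (q ∷ ps))

last-mono : ∀ {n} {v u : Word (suc n)} → v ≤ᵥ u → last v ≤ last u
last-mono (p ∷ []) = p
last-mono (_ ∷ q ∷ ps) = last-mono (q ∷ ps)

isLucas-antimono : ∀ {n} {v u : Word n} → v ≤ᵥ u → isLucas u ≤ isLucas v
isLucas-antimono [] = b≤b
isLucas-antimono (p ∷ ps) =
  ∧-mono-≤ (noConsecOnes-antimono (p ∷ ps))
           (not-antimono-≤ (∧-mono-≤ p (last-mono (p ∷ ps))))

count : ∀ {A : Set} → (A → Bool) → List A → ℕ
count f xs = length (filter (λ x → f x ≟B true) xs)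

count-++ : ∀ {A : Set} (f : A → Bool) xs ys → count f (xs ++ ys) ≡ count f xs + count f ys
count-++ f xs ys = trans (cong length (filter-++ (λ x → f x ≟B true) xs ys)) (length-++ (filter (λ x → f x ≟B true) xs))

count-map : ∀ {A B : Set} (f : B → Bool) (g : A → B) xs →
            count f (map g xs) ≡ count (λ x → f (g x)) xs
count-map f g [] = refl
count-map f g (x ∷ xs) with f (g x)
... | true = cong suc (count-map f g xs)
... | false = count-map f g xs

count-≗ : ∀ {A : Set} {f g : A → Bool} → (∀ x → f x ≡ g x) → ∀ xs → count f xs ≡ count g xs
count-≗ {f = f} {g} f≗g xs =
  cong length (filter-≐ (λ x → f x ≟B true) (λ x → g x ≟B true)
                        ((λ {x} → trans (sym (f≗g x))) , (λ {x} → trans (f≗g x))) xs)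

count-cartesianProduct : ∀ {A B : Set} (p : A × B → Bool) xs ys →
  count p (cartesianProduct xs ys) ≡ sum (map (λ x → count (λ y → p (x , y)) ys) xs)
count-cartesianProduct p [] ys = refl
count-cartesianProduct p (x ∷ xs) ys =
  trans (count-++ p (map (x ,_) ys) (cartesianProduct xs ys))
        (cong₂ _+_ (count-map p (x ,_) ys) (count-cartesianProduct p xs ys))

count-split : ∀ {A : Set} {a b : A → Bool} → (∀ x → b x ≤ a x) → ∀ xs →
              count a xs ≡ count b xs + count (λ x → a x ∧ not (b x)) xs
count-split b≤a [] = refl
count-split {a = a} {b} b≤a (x ∷ xs) with a x | b x | b≤a x
... | true | true | _ = cong suc (count-split b≤a xs)
... | true | false | _ =
  trans (cong suc (count-split b≤a xs)) (sym (+-suc _ _))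
... | false | false | _ = count-split b≤a xs

module _ {n} {y : Word n} {i : Fin n} (edge : isEdgeLow (y , i) ≡ true) where

  private
    x : Word n
    x = flip y i

    y∈Λ : isLucas y ≡ true
    y∈Λ = ∧-conicalˡ (isLucas y) _ edge

    yᵢ≡0 : lookup y i ≡ false
    yᵢ≡0 = not-injective (∧-conicalˡ (not (lookup y i)) _ (∧-conicalʳ (isLucas y) _ edge))

    x∈Λ : isLucas x ≡ true
    x∈Λ = ∧-conicalʳ (not (lookup y i)) _ (∧-conicalʳ (isLucas y) _ edge)

  upper-neighbour⇒lower-neighbour : ∀ j → isLucas (flip x j) ≤ isLucas (flip y j)
  upper-neighbour⇒lower-neighbour j with i ≟ j
  ... | yes refl = subst (isLucas (flip x i) ≤_) (sym x∈Λ) (≤-maximum _)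
  ... | no i≢j = isLucas-antimono (flip-≤ᵥ-flip-flip y yᵢ≡0 i≢j)

  imb-edge : imb (y , i) ≡ count (isImbalancedFor (y , i)) (allFin n)
  imb-edge = begin
    ∣ deg y - deg x ∣
      ≡⟨ cong (∣_- deg x ∣) (count-split upper-neighbour⇒lower-neighbour (allFin n)) ⟩
    ∣ deg x + count imbalanced (allFin n) - deg x ∣
      ≡⟨ ∣-∣-comm (deg x + count imbalanced (allFin n)) (deg x) ⟩
    ∣ deg x - deg x + count imbalanced (allFin n) ∣
      ≡⟨ ∣m-m+n∣≡n (deg x) (count imbalanced (allFin n)) ⟩
    count imbalanced (allFin n)
      ≡⟨ count-≗ (λ j → cong (_∧ imbalanced j) (sym y∈Λ)) (allFin n) ⟩
    count (isImbalancedFor (y , i)) (allFin n)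
      ∎
    where
    open ≡-Reasoning
    imbalanced : Fin n → Bool
    imbalanced j = isLucas (flip y j) ∧ not (isLucas (flip x j))

-- The identity holds for every n.
mainTheorem8 : (n : ℕ) → n ≥ 2 → irr n ≡ imbalancedPairCount n
mainTheorem8 n _ = begin
  sum (map imb (edges n))
    ≡⟨ cong sum (map-cong-local imb-edges) ⟩
  sum (map (λ e → count (isImbalancedFor e) (allFin n)) (edges n))
    ≡⟨ count-cartesianProduct (λ p → isImbalancedFor (proj₁ p) (proj₂ p)) (edges n) (allFin n) ⟨
  imbalancedPairCount n
    ∎
  where
  open ≡-Reasoning
  imb-edges : All.All (λ e → imb e ≡ count (isImbalancedFor e) (allFin n)) (edges n)
  imb-edges = All.map (λ { {y , i} → imb-edge {y = y} {i} })
                      (all-filter (λ e → isEdgeLow e ≟B true) (cartesianProduct (allWords n) (allFin n)))
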